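{- For every integer $n\geq 1$, $$p_{3,1}(n)+p_{3,2}(n)=p(n).$$
   Context: A partition of a non-negative integer $n$ is a finite multiset of positive integers (its parts) summing to $n$; $p(n)$ denotes the number of partitions of $n$. For positive integers $A,a$ and a partition $\pi$, $\mathrm{mex}_{A,a}(\pi)$ is the smallest integer $m$ with $m\geq a$ and $m\equiv a \pmod A$ (i.e. the smallest element of $\{a,a+A,a+2A,\dots\}$) that is not a part of $\pi$. Then $p_{A,a}(n)$ is the number of partitions $\pi$ of $n$ with $\mathrm{mex}_{A,a}(\pi)\equiv a \pmod{2A}$. -}

module Defs where

open import Data.Nat using (ℕ; zero; suc; _+_; _*_; _≥_; _≥?_; _≟_; NonZero)
open import Data.Nat.DivMod using (_%_)
open import Data.Nat.Properties using (m*n≢0)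
open import Data.List using (List; []; _∷_; map; concatMap; upTo; length; filter)
open import Data.Nat.ListAction using (sum)
open import Data.List.Relation.Unary.Linked using (Linked; linked?)
open import Data.List.Membership.DecPropositional _≟_ using (_∈?_)
open import Data.Product using (_×_)
open import Relation.Nullary using (Dec; yes; no)
open import Relation.Nullary.Decidable using (_×-dec_)
open import Relation.Binary.PropositionalEquality using (_≡_)

-- A partition of n (a finite multiset of positive integers summing to n)
-- is represented canonically as the list of its parts in weakly
-- decreasing order.  Positivity of parts is ensured by the enumeration
-- below (all entries are in {1,…,n}).
IsPartitionOf : ℕ → List ℕ → Set
IsPartitionOf n π = Linked _≥_ π × sum π ≡ n

isPartitionOf? : (n : ℕ) → (π : List ℕ) → Dec (IsPartitionOf n π)
isPartitionOf? n π = linked? _≥?_ π ×-dec (sum π ≟ n)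

listsOf : ℕ → ℕ → List (List ℕ)
listsOf zero    m = [] ∷ []
listsOf (suc k) m = concatMap (λ x → map (suc x ∷_) (listsOf k m)) (upTo m)

-- all lists of length ≤ n with entries in {1,…,n}; every partition of n
-- (as a weakly decreasing list) occurs exactly once among them.
candidates : ℕ → List (List ℕ)
candidates n = concatMap (λ k → listsOf k n) (upTo (suc n))

partitions : ℕ → List (List ℕ)
partitions n = filter (isPartitionOf? n) (candidates n)

p : ℕ → ℕ
p n = length (partitions n)

mexIndexFrom : ℕ → ℕ → List ℕ → ℕ → ℕ → ℕ
mexIndexFrom A a π zero       j = j
mexIndexFrom A a π (suc fuel) j with (a + A * j) ∈? π
... | yes _ = mexIndexFrom A a π fuel (suc j)
... | no  _ = j

-- mex_{A,a}(π): the smallest element of {a, a+A, a+2A, …} not a part of π.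
-- At most length π elements of the progression are parts, so fuel
-- length π suffices to reach the answer.
mex : ℕ → ℕ → List ℕ → ℕ
mex A a π = a + A * mexIndexFrom A a π (length π) 0

MexCond : (A a : ℕ) → .{{NonZero A}} → List ℕ → Set
MexCond A a π = let instance _ = m*n≢0 2 A in mex A a π % (2 * A) ≡ a % (2 * A)

mexCond? : (A a : ℕ) → .{{_ : NonZero A}} → (π : List ℕ) → Dec (MexCond A a π)
mexCond? A a π = let instance _ = m*n≢0 2 A in (mex A a π % (2 * A)) ≟ (a % (2 * A))

pMex : (A a : ℕ) → .{{NonZero A}} → ℕ → ℕ
pMex A a n = length (filter (mexCond? A a) (partitions n))

-- Let M(π) be the number of consecutive terms a, a + A, a + 2A, … of the progression that occur as
-- parts of π, so that mex_{A,a}(π) = a + A M(π) and the condition counted by p_{A,a} says that M(π)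
-- is even. Inserting or deleting the parts a, …, a + (k − 1)A shows that the partitions of n with
-- M(π) ≥ k are counted by p(n − G(k)), where G(k) = a + (a + A) + … + (a + (k − 1)A); hence
-- p_{A,a}(n) = Σₖ (−1)ᵏ p(n − G(k)). For A = 3 the numbers G(k) with a = 2 and with a = 1 are the
-- generalised pentagonal numbers ω(k) and ω(−k), where ω(j) = j (3j + 1) / 2, so that
-- p_{3,1}(n) + p_{3,2}(n) − p(n) = Σ_{j ∈ ℤ} (−1)ʲ p(n − ω(j)). This vanishes for n ≥ 1 by Euler's
-- pentagonal recurrence, which follows from the sign-reversing involution of Bressoud and Zeilberger.

module Submission where

open import Data.Empty using (⊥-elim)
open import Data.Integer.Base using (ℤ; -[1+_]) renaming (+_ to +[_])
import Data.Integer.Properties as ℤ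
open import Data.List using (List; []; _∷_; map; concatMap; upTo; length; filter; _++_; replicate; drop)
open import Data.List.Membership.Propositional using (_∈_; _∉_; find; lose)
open import Data.List.Membership.Propositional.Properties
open import Data.List.Properties
  using (length-upTo; length-++; length-map; length-replicate; filter-all; filter-none; ≡-dec)
open import Data.List.Relation.Binary.Permutation.Propositional
  using (_↭_; ↭-refl; ↭-prep; ↭-swap; ↭-sym; ↭-trans; ↭⇒↭ₛ)
open import Data.List.Relation.Binary.Permutation.Propositional.Properties
  using (∈-resp-↭; All-resp-↭; drop-∷)
open import Data.List.Relation.Binary.Pointwise using (Pointwise-≡⇒≡)
open import Data.List.Relation.Unary.All as All using (All; []; _∷_)
import Data.List.Relation.Unary.All.Properties as All
open import Data.List.Relation.Unary.AllPairs as AllPairs using (AllPairs; []; _∷_)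
import Data.List.Relation.Unary.AllPairs.Properties as AllPairs
open import Data.List.Relation.Unary.Any using (here; there)
open import Data.List.Relation.Unary.Linked.Properties using (AllPairs⇒Linked; Linked⇒AllPairs)
open import Data.List.Relation.Unary.Sorted.TotalOrder.Properties using (↗↭↗⇒≋)
open import Data.List.Relation.Unary.Unique.Propositional using (Unique)
import Data.List.Relation.Unary.Unique.Propositional.Properties as Unique
open import Data.Nat
open import Data.Nat.DivMod using (_%_; _/_; m≡m%n+[m/n]*n; [m+n]%n≡m%n)
open import Data.Nat.Divisibility using (_∣_; divides; ∣⇒≤)
open import Data.Nat.ListAction using (sum)
open import Data.Nat.ListAction.Properties using (sum-↭; sum-++)
open import Data.Nat.Properties
open import Data.Nat.Tactic.RingSolver using (solve-∀)
open import Data.Parity.Base using (Parity; 0ℙ; 1ℙ; _⁻¹)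
import Data.Parity.Properties as Parity
open import Data.Product using (_×_; _,_; proj₁; proj₂; ∃)
open import Data.Product.Properties using () renaming (≡-dec to ×-≡-dec)
open import Data.Sum using (_⊎_; inj₁; inj₂)
open import Function using (_∘_; _⇔_; mk⇔; Equivalence; case_of_)
open import Relation.Binary.Construct.Flip.EqAndOrd using (decTotalOrder; totalOrder)
open import Relation.Binary.Definitions using (DecidableEquality)
open import Relation.Binary.PropositionalEquality
open import Relation.Nullary using (Dec; yes; no; ¬_)
open import Relation.Unary.Properties using (_∩?_; ∁?)

open import Algebra.Properties.CommutativeSemigroup +-commutativeSemigroup
  using (interchange; xy∙z≈xz∙y; xy∙z≈zx∙y; xy∙z≈x∙zy; x∙yz≈yx∙z)
open import Data.List.Membership.DecPropositional _≟_ using (_∈?_)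
open import Data.List.Sort.InsertionSort.Base (decTotalOrder ≤-decTotalOrder) using (insert)
open import Data.List.Sort.InsertionSort.Properties (decTotalOrder ≤-decTotalOrder)
  using (insert-↭; insert-↗)
open import Defs

-- Counting by injections and bijections

module _ {A : Set} (_≟A_ : DecidableEquality A) where

  remove : A → List A → List A
  remove x [] = []
  remove x (y ∷ ys) with y ≟A x
  ... | yes _ = ys
  ... | no _  = y ∷ remove x ys

  length-remove : ∀ {x ys} → x ∈ ys → suc (length (remove x ys)) ≡ length ys
  length-remove {x} {y ∷ ys} x∈ with y ≟A x
  length-remove {x} {y ∷ ys} x∈          | yes _ = refl
  length-remove {x} {y ∷ ys} (here refl) | no y≢x = ⊥-elim (y≢x refl)
  length-remove {x} {y ∷ ys} (there x∈)  | no _ = cong suc (length-remove x∈)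

  ∈-remove⁺ : ∀ {x y ys} → y ∈ ys → y ≢ x → y ∈ remove x ys
  ∈-remove⁺ {x} {y} {z ∷ ys} y∈ y≢x with z ≟A x
  ∈-remove⁺ {x} {y} {z ∷ ys} (here refl) y≢x | yes z≡x = ⊥-elim (y≢x z≡x)
  ∈-remove⁺ {x} {y} {z ∷ ys} (there y∈)  y≢x | yes _   = y∈
  ∈-remove⁺ {x} {y} {z ∷ ys} (here refl) y≢x | no _    = here refl
  ∈-remove⁺ {x} {y} {z ∷ ys} (there y∈)  y≢x | no _    = there (∈-remove⁺ y∈ y≢x)

  injection⇒length≤ : {B : Set} (f : B → A) {xs : List B} {ys : List A} → Unique xs →
    (∀ {x} → x ∈ xs → f x ∈ ys) →
    (∀ {x x′} → x ∈ xs → x′ ∈ xs → f x ≡ f x′ → x ≡ x′) →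
    length xs ≤ length ys
  injection⇒length≤ f {[]} _ _ _ = z≤n
  injection⇒length≤ f {x ∷ xs} {ys} (x∉xs ∷ uxs) maps inj =
    subst (_ ≤_) (length-remove (maps (here refl)))
      (s≤s (injection⇒length≤ f uxs maps′ (λ p q → inj (there p) (there q))))
    where
    maps′ : ∀ {x′} → x′ ∈ xs → f x′ ∈ remove (f x) ys
    maps′ x′∈ = ∈-remove⁺ (maps (there x′∈))
      λ eq → All.lookup x∉xs x′∈ (sym (inj (there x′∈) (here refl) eq))

bijection⇒length≡ : {A B : Set} → DecidableEquality A → DecidableEquality B →
  {xs : List A} {ys : List B} → Unique xs → Unique ys →
  (f : A → B) (g : B → A) →
  (∀ {x} → x ∈ xs → f x ∈ ys) → (∀ {y} → y ∈ ys → g y ∈ xs) →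
  (∀ {x} → x ∈ xs → g (f x) ≡ x) → (∀ {y} → y ∈ ys → f (g y) ≡ y) →
  length xs ≡ length ys
bijection⇒length≡ _≟A_ _≟B_ uxs uys f g f∈ g∈ gf fg = ≤-antisym
  (injection⇒length≤ _≟B_ f uxs f∈ λ p q eq → trans (sym (gf p)) (trans (cong g eq) (gf q)))
  (injection⇒length≤ _≟A_ g uys g∈ λ p q eq → trans (sym (fg p)) (trans (cong f eq) (fg q)))

module _ {A : Set} where

  length-filter-cong : {P Q : A → Set} (P? : (x : A) → Dec (P x)) (Q? : (x : A) → Dec (Q x))
    (xs : List A) → (∀ {x} → x ∈ xs → P x ⇔ Q x) → length (filter P? xs) ≡ length (filter Q? xs)
  length-filter-cong P? Q? [] P⇔Q = refl
  length-filter-cong P? Q? (x ∷ xs) P⇔Q with P? x | Q? x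
  ... | yes _  | yes _  = cong suc (length-filter-cong P? Q? xs (P⇔Q ∘ there))
  ... | no _   | no _   = length-filter-cong P? Q? xs (P⇔Q ∘ there)
  ... | yes px | no ¬qx = ⊥-elim (¬qx (Equivalence.to (P⇔Q (here refl)) px))
  ... | no ¬px | yes qx = ⊥-elim (¬px (Equivalence.from (P⇔Q (here refl)) qx))

  length-filter-split : {P Q : A → Set} (P? : (x : A) → Dec (P x)) (Q? : (x : A) → Dec (Q x))
    (xs : List A) →
    length (filter P? xs) ≡ length (filter (P? ∩? Q?) xs) + length (filter (P? ∩? ∁? Q?) xs)
  length-filter-split P? Q? [] = refl
  length-filter-split P? Q? (x ∷ xs) with P? x | Q? x
  ... | yes _ | yes _ = cong suc (length-filter-split P? Q? xs)
  ... | yes _ | no _  = trans (cong suc (length-filter-split P? Q? xs)) (sym (+-suc _ _))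
  ... | no _  | _     = length-filter-split P? Q? xs

  unique-concatMap : {B : Set} {f : A → List B} {xs : List A} → Unique xs → (∀ x → Unique (f x)) →
    (∀ {x x′ y} → y ∈ f x → y ∈ f x′ → x ≡ x′) → Unique (concatMap f xs)
  unique-concatMap {xs = []} _ _ _ = []
  unique-concatMap {f = f} {xs = x ∷ xs} (x∉xs ∷ uxs) uf disjoint =
    Unique.++⁺ (uf x) (unique-concatMap uxs uf disjoint) λ (y∈fx , y∈rest) →
      let (x′ , x′∈xs , y∈fx′) = find (∈-concatMap⁻ f {xs = xs} y∈rest)
      in All.lookup x∉xs x′∈xs (disjoint y∈fx y∈fx′)

-- Partitions

infix 4 _⊢_
_⊢_ : List ℕ → ℕ → Set
π ⊢ n = AllPairs _≥_ π × All (0 <_) π × sum π ≡ n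

∈⇒≤sum : ∀ {x π} → x ∈ π → x ≤ sum π
∈⇒≤sum {π = y ∷ π} (here refl) = m≤m+n y (sum π)
∈⇒≤sum {π = y ∷ π} (there x∈) = ≤-trans (∈⇒≤sum x∈) (m≤n+m (sum π) y)

length≤sum : ∀ {π} → All (0 <_) π → length π ≤ sum π
length≤sum []         = z≤n
length≤sum (0<x ∷ π⁺) = +-mono-≤ 0<x (length≤sum π⁺)

listsOf-shape : ∀ {k m π} → π ∈ listsOf k m → All (0 <_) π × length π ≡ k
listsOf-shape {zero} (here refl) = [] , refl
listsOf-shape {suc k} {m} π∈ with find (∈-concatMap⁻ _ {xs = upTo m} π∈)
... | x , _ , π∈′ with ∈-map⁻ (suc x ∷_) π∈′
... | π′ , π′∈ , refl =
  let (π′⁺ , len) = listsOf-shape {k} π′∈ in (s≤s z≤n ∷ π′⁺) , cong suc len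

∈-listsOf : ∀ {m π} → All (λ x → 0 < x × x ≤ m) π → π ∈ listsOf (length π) m
∈-listsOf [] = here refl
∈-listsOf {m} {suc x ∷ π} ((_ , x<m) ∷ bounded) =
  ∈-concatMap⁺ (λ y → map (suc y ∷_) (listsOf (length π) m))
    (lose (∈-upTo⁺ x<m) (∈-map⁺ (suc x ∷_) (∈-listsOf bounded)))

listsOf-unique : ∀ k m → Unique (listsOf k m)
listsOf-unique zero m = [] ∷ []
listsOf-unique (suc k) m =
  unique-concatMap (Unique.upTo⁺ m) (λ _ → Unique.map⁺ (λ { refl → refl }) (listsOf-unique k m)) heads
  where
  heads : ∀ {x x′ π} → π ∈ map (suc x ∷_) (listsOf k m) → π ∈ map (suc x′ ∷_) (listsOf k m) →
    x ≡ x′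
  heads p q with ∈-map⁻ _ p | ∈-map⁻ _ q
  ... | _ , _ , refl | _ , _ , refl = refl

∈-partitions⁻ : ∀ {n π} → π ∈ partitions n → π ⊢ n
∈-partitions⁻ {n} π∈ with ∈-filter⁻ (isPartitionOf? n) {xs = candidates n} π∈
... | π∈cands , (linked , sum≡n) with find (∈-concatMap⁻ _ {xs = upTo (suc n)} π∈cands)
... | k , _ , π∈listsOf =
  Linked⇒AllPairs (λ x≥y y≥z → ≤-trans y≥z x≥y) linked ,
  proj₁ (listsOf-shape {k} π∈listsOf) ,
  sum≡n

∈-partitions⁺ : ∀ {n π} → π ⊢ n → π ∈ partitions n
∈-partitions⁺ {n} {π} (sorted , π⁺ , sum≡n) =
  ∈-filter⁺ (isPartitionOf? n)
    (∈-concatMap⁺ (λ k → listsOf k n) (lose (∈-upTo⁺ (s≤s length≤n)) (∈-listsOf bounded)))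
    (AllPairs⇒Linked sorted , sum≡n)
  where
  length≤n : length π ≤ n
  length≤n = subst (length π ≤_) sum≡n (length≤sum π⁺)
  bounded : All (λ x → 0 < x × x ≤ n) π
  bounded = All.tabulate λ x∈ → All.lookup π⁺ x∈ , subst (_ ≤_) sum≡n (∈⇒≤sum x∈)

partitions-unique : ∀ n → Unique (partitions n)
partitions-unique n = Unique.filter⁺ (isPartitionOf? n)
  (unique-concatMap (Unique.upTo⁺ (suc n)) (λ k → listsOf-unique k n)
    (λ p q → trans (sym (proj₂ (listsOf-shape p))) (proj₂ (listsOf-shape q))))

removePart : ℕ → List ℕ → List ℕ
removePart = remove _≟_

x∈insert : ∀ x π → x ∈ insert x π
x∈insert x π = ∈-resp-↭ (↭-sym (insert-↭ x π)) (here refl)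

∈-insert⁺ : ∀ {x y π} → y ∈ π → y ∈ insert x π
∈-insert⁺ {x} {π = π} y∈ = ∈-resp-↭ (↭-sym (insert-↭ x π)) (there y∈)

insert-⊢ : ∀ {x n π} → 0 < x → π ⊢ n → insert x π ⊢ x + n
insert-⊢ {x} {π = π} 0<x (sorted , π⁺ , sum≡n) =
  Linked⇒AllPairs (λ x≥y y≥z → ≤-trans y≥z x≥y) (insert-↗ x (AllPairs⇒Linked sorted)) ,
  All-resp-↭ (↭-sym (insert-↭ x π)) (0<x ∷ π⁺) ,
  trans (sum-↭ (insert-↭ x π)) (cong (x +_) sum≡n)

All-removePart : ∀ {P : ℕ → Set} {x π} → All P π → All P (removePart x π)
All-removePart {x = x} {[]} [] = []
All-removePart {x = x} {y ∷ π} (py ∷ pπ) with y ≟ x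
... | yes _ = pπ
... | no _  = py ∷ All-removePart pπ

removePart-↭ : ∀ {x π} → x ∈ π → π ↭ x ∷ removePart x π
removePart-↭ {x} {y ∷ π} x∈ with y ≟ x
removePart-↭ {x} {y ∷ π} x∈          | yes refl = ↭-refl
removePart-↭ {x} {y ∷ π} (here refl) | no y≢x = ⊥-elim (y≢x refl)
removePart-↭ {x} {y ∷ π} (there x∈)  | no _ =
  ↭-trans (↭-prep y (removePart-↭ x∈)) (↭-swap y x ↭-refl)

removePart-⊢ : ∀ {x n π} → x ∈ π → π ⊢ x + n → removePart x π ⊢ n
removePart-⊢ {x} {n} {π} x∈ (sorted , π⁺ , sum≡x+n) = sortedRemoved sorted , All-removePart π⁺ ,
  +-cancelˡ-≡ x _ _ (trans (sum-↭ (↭-sym (removePart-↭ x∈))) sum≡x+n)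
  where
  sortedRemoved : ∀ {π} → AllPairs _≥_ π → AllPairs _≥_ (removePart x π)
  sortedRemoved [] = []
  sortedRemoved {y ∷ π} (y≥π ∷ sortedπ) with y ≟ x
  ... | yes _ = sortedπ
  ... | no _  = All-removePart y≥π ∷ sortedRemoved sortedπ

decreasing-↭⇒≡ : ∀ {xs ys} → AllPairs _≥_ xs → AllPairs _≥_ ys → xs ↭ ys → xs ≡ ys
decreasing-↭⇒≡ xs↘ ys↘ xs↭ys = Pointwise-≡⇒≡
  (↗↭↗⇒≋ (totalOrder ≤-totalOrder) (AllPairs⇒Linked xs↘) (AllPairs⇒Linked ys↘)
    (↭⇒↭ₛ xs↭ys))

removePart-insert : ∀ {x n π} → 0 < x → π ⊢ n → removePart x (insert x π) ≡ π
removePart-insert {x} {π = π} 0<x π⊢n = decreasing-↭⇒≡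
  (proj₁ (removePart-⊢ (x∈insert x π) (insert-⊢ 0<x π⊢n))) (proj₁ π⊢n)
  (drop-∷ (↭-trans (↭-sym (removePart-↭ (x∈insert x π))) (insert-↭ x π)))

insert-removePart : ∀ {x n π} → x ∈ π → π ⊢ x + n → insert x (removePart x π) ≡ π
insert-removePart {x} {π = π} x∈ π⊢x+n = decreasing-↭⇒≡
  (proj₁ (insert-⊢ (All.lookup (proj₁ (proj₂ π⊢x+n)) x∈) (removePart-⊢ x∈ π⊢x+n)))
  (proj₁ π⊢x+n)
  (↭-trans (insert-↭ x (removePart x π)) (↭-sym (removePart-↭ x∈)))

-- The mex condition as a parity condition

parity-suc : ∀ n → parity (suc n) ≡ parity n ⁻¹
parity-suc zero          = refl
parity-suc (suc zero)    = refl
parity-suc (suc (suc n)) = parity-suc n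

parity-suc⁺ : ∀ k {p} → parity k ≡ p → parity (suc k) ≡ p ⁻¹
parity-suc⁺ k parity≡ = trans (parity-suc k) (cong _⁻¹ parity≡)

parity-suc⁻ : ∀ k {p} → parity (suc k) ≡ p → parity k ≡ p ⁻¹
parity-suc⁻ k parity≡ = sym (Parity.⁻¹-selfInverse (trans (sym (parity-suc k)) parity≡))

p⁻¹≢0ℙ⇔p≡0ℙ : ∀ p → p ⁻¹ ≢ 0ℙ ⇔ p ≡ 0ℙ
p⁻¹≢0ℙ⇔p≡0ℙ 0ℙ = mk⇔ (λ _ → refl) (λ _ ())
p⁻¹≢0ℙ⇔p≡0ℙ 1ℙ = mk⇔ (λ 0ℙ≢0ℙ → ⊥-elim (0ℙ≢0ℙ refl)) (λ ())

module _ (A : ℕ) .{{_ : NonZero A}} where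
  private instance
    2A≢0 : NonZero (2 * A)
    2A≢0 = m*n≢0 2 A

  [a+A]%[2A]≢a%[2A] : ∀ a → (a + A) % (2 * A) ≢ a % (2 * A)
  [a+A]%[2A]≢a%[2A] a same = <⇒≱ A<2A (∣⇒≤ 2A∣A)
    where
    A<2A : A < 2 * A
    A<2A = subst (_< 2 * A) (*-identityˡ A) (*-monoˡ-< A {1} {2} (s≤s (s≤s z≤n)))
    open ≡-Reasoning
    d = 2 * A
    q₀ = a / d
    q₁ = (a + A) / d
    2A∣A : d ∣ A
    2A∣A = divides (q₁ ∸ q₀) (begin
      A
        ≡⟨ m+n∸m≡n a A ⟨
      a + A ∸ a
        ≡⟨ cong₂ _∸_ (m≡m%n+[m/n]*n (a + A) d) (m≡m%n+[m/n]*n a d) ⟩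
      ((a + A) % d + q₁ * d) ∸ (a % d + q₀ * d)
        ≡⟨ cong (λ r → (r + q₁ * d) ∸ (a % d + q₀ * d)) same ⟩
      (a % d + q₁ * d) ∸ (a % d + q₀ * d)
        ≡⟨ [m+n]∸[m+o]≡n∸o (a % d) (q₁ * d) (q₀ * d) ⟩
      q₁ * d ∸ q₀ * d
        ≡⟨ *-distribʳ-∸ d q₁ q₀ ⟨
      (q₁ ∸ q₀) * d
        ∎)

  [a+A*m]%[2A]≡a%[2A]⇔parity[m]≡0ℙ : ∀ a m →
    (a + A * m) % (2 * A) ≡ a % (2 * A) ⇔ parity m ≡ 0ℙ
  [a+A*m]%[2A]≡a%[2A]⇔parity[m]≡0ℙ a zero =
    mk⇔ (λ _ → refl) (λ _ → cong (_% (2 * A)) (trans (cong (a +_) (*-zeroʳ A)) (+-identityʳ a)))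
  [a+A*m]%[2A]≡a%[2A]⇔parity[m]≡0ℙ a (suc zero) =
    mk⇔ (λ same → ⊥-elim ([a+A]%[2A]≢a%[2A] a (trans a+A≡a+A*1 same))) λ ()
    where
    a+A≡a+A*1 : (a + A) % (2 * A) ≡ (a + A * 1) % (2 * A)
    a+A≡a+A*1 = cong (λ x → (a + x) % (2 * A)) (sym (*-identityʳ A))
  [a+A*m]%[2A]≡a%[2A]⇔parity[m]≡0ℙ a (suc (suc m)) = mk⇔
    (λ same → Equivalence.to ih (trans (sym period) same))
    (λ ev → trans period (Equivalence.from ih ev))
    where
    ih = [a+A*m]%[2A]≡a%[2A]⇔parity[m]≡0ℙ a m
    period-shift : ∀ a A m → a + A * suc (suc m) ≡ (a + A * m) + 2 * A
    period-shift = solve-∀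
    period : (a + A * suc (suc m)) % (2 * A) ≡ (a + A * m) % (2 * A)
    period = trans (cong (_% (2 * A)) (period-shift a A m)) ([m+n]%n≡m%n (a + A * m) (2 * A))

mexIndex : ℕ → ℕ → List ℕ → ℕ
mexIndex A a π = mexIndexFrom A a π (length π) 0

HasRun : ℕ → ℕ → ℕ → List ℕ → Set
HasRun A a k π = ∀ i → i < k → a + A * i ∈ π

a+A*-injective : ∀ {A} .{{_ : NonZero A}} a {i j} → a + A * i ≡ a + A * j → i ≡ j
a+A*-injective {A} a eq = *-cancelˡ-≡ _ _ A (+-cancelˡ-≡ a _ _ eq)

module _ (A a : ℕ) (π : List ℕ) where

  mexIndexFrom-run : ∀ fuel j i → j ≤ i → i < mexIndexFrom A a π fuel j → a + A * i ∈ π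
  mexIndexFrom-run zero j i j≤i i<j = ⊥-elim (<⇒≱ i<j j≤i)
  mexIndexFrom-run (suc fuel) j i j≤i i<r with (a + A * j) ∈? π
  ... | no _ = ⊥-elim (<⇒≱ i<r j≤i)
  ... | yes j∈ with m≤n⇒m<n∨m≡n j≤i
  ...   | inj₁ j<i  = mexIndexFrom-run fuel (suc j) i j<i i<r
  ...   | inj₂ refl = j∈

  mexIndexFrom-stop : ∀ fuel j →
    a + A * mexIndexFrom A a π fuel j ∉ π ⊎ mexIndexFrom A a π fuel j ≡ j + fuel
  mexIndexFrom-stop zero j = inj₂ (sym (+-identityʳ j))
  mexIndexFrom-stop (suc fuel) j with (a + A * j) ∈? π
  ... | no j∉ = inj₁ j∉
  ... | yes _ with mexIndexFrom-stop fuel (suc j)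
  ...   | inj₁ r∉ = inj₁ r∉
  ...   | inj₂ exhausted = inj₂ (trans exhausted (sym (+-suc j fuel)))

  mexIndexFrom-≤ : ∀ fuel j → mexIndexFrom A a π fuel j ≤ j + fuel
  mexIndexFrom-≤ zero j = ≤-reflexive (sym (+-identityʳ j))
  mexIndexFrom-≤ (suc fuel) j with (a + A * j) ∈? π
  ... | yes _ = ≤-trans (mexIndexFrom-≤ fuel (suc j)) (≤-reflexive (sym (+-suc j fuel)))
  ... | no _  = m≤m+n j (suc fuel)

  mexIndex≤length : mexIndex A a π ≤ length π
  mexIndex≤length = mexIndexFrom-≤ (length π) 0

  HasRun-mexIndex : HasRun A a (mexIndex A a π) π
  HasRun-mexIndex i = mexIndexFrom-run (length π) 0 i z≤n

  -- The fuel length π does not run out: the search would otherwise have found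
  -- length π + 1 distinct parts of π.
  mex∉ : .{{NonZero A}} → a + A * mexIndex A a π ∉ π
  mex∉ mex∈ with mexIndexFrom-stop (length π) 0
  ... | inj₁ mex∉π = mex∉π mex∈
  ... | inj₂ exhausted = <-irrefl refl (subst (_≤ length π) (length-upTo (suc (length π)))
        (injection⇒length≤ _≟_ (λ i → a + A * i) (Unique.upTo⁺ (suc (length π))) inRun
          (λ _ _ → a+A*-injective a)))
    where
    inRun : ∀ {i} → i ∈ upTo (suc (length π)) → a + A * i ∈ π
    inRun i∈ with m≤n⇒m<n∨m≡n (≤-pred (∈-upTo⁻ i∈))
    ... | inj₁ i<length = HasRun-mexIndex _ (subst (_ <_) (sym exhausted) i<length)
    ... | inj₂ refl     = subst (λ m → a + A * m ∈ π) exhausted mex∈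

  ≤mexIndex⇔HasRun : .{{NonZero A}} → ∀ k → k ≤ mexIndex A a π ⇔ HasRun A a k π
  ≤mexIndex⇔HasRun k = mk⇔ (λ k≤ i i<k → HasRun-mexIndex i (<-≤-trans i<k k≤)) λ run →
    ≮⇒≥ λ mex<k → mex∉ (run (mexIndex A a π) mex<k)

  MexCond⇔parity≡0ℙ : .{{_ : NonZero A}} → MexCond A a π ⇔ parity (mexIndex A a π) ≡ 0ℙ
  MexCond⇔parity≡0ℙ = [a+A*m]%[2A]≡a%[2A]⇔parity[m]≡0ℙ A a (mexIndex A a π)

-- Partitions containing a, a + A, …, a + (k − 1)A

progressionSum : ℕ → ℕ → ℕ → ℕ
progressionSum A a zero    = 0
progressionSum A a (suc k) = (a + A * k) + progressionSum A a k

-- p(n − g), where the number of partitions of a negative number is 0.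
pMinus : ℕ → ℕ → ℕ
pMinus n g with g ≤? n
... | yes _ = p (n ∸ g)
... | no _  = 0

pMinus-> : ∀ {n g} → n < g → pMinus n g ≡ 0
pMinus-> {n} {g} n<g with g ≤? n
... | yes g≤n = ⊥-elim (<⇒≱ n<g g≤n)
... | no _    = refl

pMinus-+ : ∀ x m g → pMinus (x + m) (x + g) ≡ pMinus m g
pMinus-+ x m g with x + g ≤? x + m | g ≤? m
... | yes _ | yes _ = cong p ([m+n]∸[m+o]≡n∸o x m g)
... | no _  | no _  = refl
... | yes x+g≤x+m | no g≰m = ⊥-elim (g≰m (+-cancelˡ-≤ x g m x+g≤x+m))
... | no x+g≰x+m  | yes g≤m = ⊥-elim (x+g≰x+m (+-monoʳ-≤ x g≤m))

partitionsWithRun : (A a n k : ℕ) → List (List ℕ)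
partitionsWithRun A a n k = filter (λ π → k ≤? mexIndex A a π) (partitions n)

module _ (A a : ℕ) .{{_ : NonZero A}} where

  ∈-partitionsWithRun⁻ : ∀ {n k π} → π ∈ partitionsWithRun A a n k → π ⊢ n × HasRun A a k π
  ∈-partitionsWithRun⁻ {n} {k} {π} π∈ =
    let (π∈ , k≤) = ∈-filter⁻ (λ π → k ≤? mexIndex A a π) {xs = partitions n} π∈
    in ∈-partitions⁻ π∈ , Equivalence.to (≤mexIndex⇔HasRun A a π k) k≤

  ∈-partitionsWithRun⁺ : ∀ {n k π} → π ⊢ n → HasRun A a k π → π ∈ partitionsWithRun A a n k
  ∈-partitionsWithRun⁺ {n} {k} {π} π⊢n run =
    ∈-filter⁺ (λ π → k ≤? mexIndex A a π) (∈-partitions⁺ π⊢n)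
      (Equivalence.from (≤mexIndex⇔HasRun A a π k) run)

  HasRun-removePart : ∀ {k π} → HasRun A a (suc k) π → HasRun A a k (removePart (a + A * k) π)
  HasRun-removePart run i i<k =
    ∈-remove⁺ _≟_ (run i (m<n⇒m<1+n i<k)) (<⇒≢ i<k ∘ a+A*-injective a)

  HasRun-insert : ∀ {k π} → HasRun A a k π → HasRun A a (suc k) (insert (a + A * k) π)
  HasRun-insert {k} {π} run i i<1+k with m≤n⇒m<n∨m≡n (≤-pred i<1+k)
  ... | inj₁ i<k  = ∈-insert⁺ (run i i<k)
  ... | inj₂ refl = x∈insert (a + A * k) π

  length-partitionsWithRun-suc : ∀ n k → 0 < a →
    length (partitionsWithRun A a ((a + A * k) + n) (suc k)) ≡ length (partitionsWithRun A a n k)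
  length-partitionsWithRun-suc n k 0<a = bijection⇒length≡ (≡-dec _≟_) (≡-dec _≟_)
    (Unique.filter⁺ (λ π → suc k ≤? mexIndex A a π) (partitions-unique (x + n)))
    (Unique.filter⁺ (λ π → k ≤? mexIndex A a π) (partitions-unique n))
    (removePart x) (insert x)
    (λ π∈ → let (π⊢ , run) = ∈-partitionsWithRun⁻ {x + n} {suc k} π∈
            in ∈-partitionsWithRun⁺ (removePart-⊢ (run k ≤-refl) π⊢) (HasRun-removePart run))
    (λ π∈ → let (π⊢ , run) = ∈-partitionsWithRun⁻ {n} {k} π∈
            in ∈-partitionsWithRun⁺ (insert-⊢ 0<x π⊢) (HasRun-insert run))
    (λ π∈ → let (π⊢ , run) = ∈-partitionsWithRun⁻ {x + n} {suc k} π∈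
            in insert-removePart (run k ≤-refl) π⊢)
    (λ π∈ → removePart-insert 0<x (proj₁ (∈-partitionsWithRun⁻ {n} {k} π∈)))
    where
    x = a + A * k
    0<x : 0 < x
    0<x = ≤-trans 0<a (m≤m+n a (A * k))

  length-partitionsWithRun-> : ∀ {n} k → n < a + A * k → length (partitionsWithRun A a n (suc k)) ≡ 0
  length-partitionsWithRun-> {n} k n<x =
    cong length (filter-none (λ π → suc k ≤? mexIndex A a π) {xs = partitions n}
      (All.tabulate λ {π} π∈ k<mex →
        let (_ , _ , sum≡n) = ∈-partitions⁻ π∈
            run = Equivalence.to (≤mexIndex⇔HasRun A a π (suc k)) k<mex
        in <⇒≱ n<x (subst (_ ≤_) sum≡n (∈⇒≤sum (run k ≤-refl)))))

  length-partitionsWithRun : ∀ n k → 0 < a →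
    length (partitionsWithRun A a n k) ≡ pMinus n (progressionSum A a k)
  length-partitionsWithRun n zero _ =
    cong length (filter-all (λ π → 0 ≤? mexIndex A a π) {xs = partitions n} (All.tabulate λ _ → z≤n))
  length-partitionsWithRun n (suc k) 0<a with a + A * k ≤? n
  ... | no x≰n = trans (length-partitionsWithRun-> k (≰⇒> x≰n))
    (sym (pMinus-> (<-≤-trans (≰⇒> x≰n) (m≤m+n _ _))))
  ... | yes x≤n = begin
    length (partitionsWithRun A a n (suc k))
      ≡⟨ cong (λ n → length (partitionsWithRun A a n (suc k))) (sym (m+[n∸m]≡n x≤n)) ⟩
    length (partitionsWithRun A a (x + (n ∸ x)) (suc k))
      ≡⟨ length-partitionsWithRun-suc (n ∸ x) k 0<a ⟩
    length (partitionsWithRun A a (n ∸ x) k)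
      ≡⟨ length-partitionsWithRun (n ∸ x) k 0<a ⟩
    pMinus (n ∸ x) (progressionSum A a k)
      ≡⟨ pMinus-+ x (n ∸ x) _ ⟨
    pMinus (x + (n ∸ x)) (x + progressionSum A a k)
      ≡⟨ cong (λ n → pMinus n (progressionSum A a (suc k))) (m+[n∸m]≡n x≤n) ⟩
    pMinus n (progressionSum A a (suc k)) ∎
    where
    open ≡-Reasoning
    x = a + A * k

-- p_{A,a} as an alternating sum

-- paritySum p c m is the sum of the c k over the k < m with parity k ≡ p.
paritySum : Parity → (ℕ → ℕ) → ℕ → ℕ
paritySum p  c zero    = 0
paritySum 0ℙ c (suc m) = c 0 + paritySum 1ℙ (c ∘ suc) m
paritySum 1ℙ c (suc m) = paritySum 0ℙ (c ∘ suc) m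

paritySum-telescope : ∀ m (c e : ℕ → ℕ) → (∀ k → c k ≡ e k + e (suc k)) → e m ≡ 0 →
  e 0 + paritySum 1ℙ c m ≡ paritySum 0ℙ c m
paritySum-telescope zero    c e c≡ e0 = trans (+-identityʳ (e 0)) e0
paritySum-telescope (suc m) c e c≡ em = begin
  e 0 + paritySum 0ℙ (c ∘ suc) m         ≡⟨ cong (e 0 +_) ih ⟨
  e 0 + (e 1 + paritySum 1ℙ (c ∘ suc) m) ≡⟨ +-assoc (e 0) (e 1) _ ⟨
  (e 0 + e 1) + paritySum 1ℙ (c ∘ suc) m ≡⟨ cong (_+ paritySum 1ℙ (c ∘ suc) m) (c≡ 0) ⟨
  c 0 + paritySum 1ℙ (c ∘ suc) m         ∎
  where
  open ≡-Reasoning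
  ih = paritySum-telescope m (c ∘ suc) (e ∘ suc) (c≡ ∘ suc) em

∸-suc : ∀ {m k} → k < m → m ∸ k ≡ suc (m ∸ suc k)
∸-suc {suc m} {zero}  _         = refl
∸-suc {suc m} {suc k} (s≤s k<m) = ∸-suc k<m

module _ (A a n : ℕ) .{{_ : NonZero A}} where
  private
    EvenExcess : ℕ → List ℕ → Set
    EvenExcess k π = parity (mexIndex A a π ∸ k) ≡ 0ℙ

    evenExcess? : ∀ k π → Dec (EvenExcess k π)
    evenExcess? k π = parity (mexIndex A a π ∸ k) Parity.≟ 0ℙ

    runAtLeast? : ∀ k π → Dec (k ≤ mexIndex A a π)
    runAtLeast? k π = k ≤? mexIndex A a π

    evenExcessCount : ℕ → ℕ
    evenExcessCount k = length (filter (runAtLeast? k ∩? evenExcess? k) (partitions n))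

    oddExcess⇔evenExcess-suc : ∀ k π →
      (k ≤ mexIndex A a π × ¬ EvenExcess k π) ⇔ (suc k ≤ mexIndex A a π × EvenExcess (suc k) π)
    oddExcess⇔evenExcess-suc k π = mk⇔
      (λ (k≤ , odd) → case m≤n⇒m<n∨m≡n k≤ of λ where
        (inj₂ refl) → ⊥-elim (odd (cong parity (n∸n≡0 k)))
        (inj₁ k<)   → k< , Equivalence.to (p⁻¹≢0ℙ⇔p≡0ℙ _) (odd ∘ trans (excess-flip k<)))
      (λ (k< , ev) → <⇒≤ k< , Equivalence.from (p⁻¹≢0ℙ⇔p≡0ℙ _) ev ∘ trans (sym (excess-flip k<)))
      where
      excess-flip : k < mexIndex A a π → parity (mexIndex A a π ∸ k) ≡ parity (mexIndex A a π ∸ suc k) ⁻¹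
      excess-flip k< = trans (cong parity (∸-suc k<)) (parity-suc (mexIndex A a π ∸ suc k))

    length-partitionsWithRun≡evenExcess : ∀ k →
      length (partitionsWithRun A a n k) ≡ evenExcessCount k + evenExcessCount (suc k)
    length-partitionsWithRun≡evenExcess k =
      trans (length-filter-split (runAtLeast? k) (evenExcess? k) (partitions n))
        (cong (evenExcessCount k +_)
          (length-filter-cong _ _ (partitions n) λ {π} _ → oddExcess⇔evenExcess-suc k π))

    evenExcessCount-vanishes : evenExcessCount (suc n) ≡ 0
    evenExcessCount-vanishes = cong length (filter-none (runAtLeast? (suc n) ∩? evenExcess? (suc n))
      {xs = partitions n} (All.tabulate λ {π} π∈ (n<mex , _) →
        let (_ , π⁺ , sum≡n) = ∈-partitions⁻ π∈
        in <⇒≱ n<mex (≤-trans (mexIndex≤length A a π) (subst (length π ≤_) sum≡n (length≤sum π⁺)))))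

    pMex≡evenExcessCount : pMex A a n ≡ evenExcessCount 0
    pMex≡evenExcessCount = length-filter-cong _ _ (partitions n) λ {π} _ →
      mk⇔ (λ mexCond → z≤n , Equivalence.to (MexCond⇔parity≡0ℙ A a π) mexCond)
          (λ (_ , ev) → Equivalence.from (MexCond⇔parity≡0ℙ A a π) ev)

  pMex-alternating : 0 < a →
    pMex A a n + paritySum 1ℙ (λ k → pMinus n (progressionSum A a k)) (suc n) ≡
    paritySum 0ℙ (λ k → pMinus n (progressionSum A a k)) (suc n)
  pMex-alternating 0<a = trans (cong (_+ paritySum 1ℙ c (suc n)) pMex≡evenExcessCount)
    (paritySum-telescope (suc n) c evenExcessCount
      (λ k → trans (sym (length-partitionsWithRun A a n k 0<a)) (length-partitionsWithRun≡evenExcess k))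
      evenExcessCount-vanishes)
    where
    c : ℕ → ℕ
    c k = pMinus n (progressionSum A a k)

-- Euler's pentagonal recurrence

-- the generalised pentagonal number ω(j) = j (3j + 1) / 2
pentagonal : ℤ → ℕ
pentagonal +[ k ]   = progressionSum 3 2 k
pentagonal -[1+ k ] = progressionSum 3 1 (suc k)

parityℤ : ℤ → Parity
parityℤ +[ k ]   = parity k
parityℤ -[1+ k ] = parity (suc k)

lower raise : ℤ → ℤ
lower +[ zero ]    = -[1+ 0 ]
lower +[ suc k ]   = +[ k ]
lower -[1+ k ]     = -[1+ suc k ]
raise +[ k ]       = +[ suc k ]
raise -[1+ zero ]  = +[ zero ]
raise -[1+ suc k ] = -[1+ k ]

-- 3j = up j − down j, with one of the two zero.
up down : ℤ → ℕ
up +[ k ]     = 3 * k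
up -[1+ _ ]   = 0
down +[ _ ]   = 0
down -[1+ k ] = 3 * suc k

raise-lower : ∀ j → raise (lower j) ≡ j
raise-lower +[ zero ]  = refl
raise-lower +[ suc k ] = refl
raise-lower -[1+ k ]   = refl

lower-raise : ∀ j → lower (raise j) ≡ j
lower-raise +[ k ]        = refl
lower-raise -[1+ zero ]   = refl
lower-raise -[1+ suc k ]  = refl

parityℤ-lower : ∀ j → parityℤ (lower j) ≡ parityℤ j ⁻¹
parityℤ-lower +[ zero ]  = refl
parityℤ-lower +[ suc k ] = parity-suc⁻ k refl
parityℤ-lower -[1+ k ]   = parity-suc⁻ k refl

parityℤ-raise : ∀ j → parityℤ (raise j) ≡ parityℤ j ⁻¹
parityℤ-raise j =
  sym (Parity.⁻¹-selfInverse (sym lowered))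
  where
  lowered : parityℤ j ≡ parityℤ (raise j) ⁻¹
  lowered = trans (cong parityℤ (sym (lower-raise j))) (parityℤ-lower (raise j))

up-lower : ∀ j → up (lower j) + 3 + down j ≡ up j + down (lower j)
up-lower +[ zero ]  = refl
up-lower +[ suc k ] = shift k
  where
  shift : ∀ k → 3 * k + 3 + 0 ≡ 3 * suc k + 0
  shift = solve-∀
up-lower -[1+ k ]  = shift k
  where
  shift : ∀ k → 0 + 3 + 3 * suc k ≡ 0 + 3 * suc (suc k)
  shift = solve-∀

pentagonal-lower : ∀ j → pentagonal (lower j) + up j ≡ pentagonal j + suc (down j)
pentagonal-lower +[ zero ]  = refl
pentagonal-lower +[ suc k ] = shift k (progressionSum 3 2 k)
  where
  shift : ∀ k s → s + 3 * suc k ≡ (2 + 3 * k + s) + 1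
  shift = solve-∀
pentagonal-lower -[1+ k ]  = shift k (progressionSum 3 1 (suc k))
  where
  shift : ∀ k s → (1 + 3 * suc k + s) + 0 ≡ s + suc (3 * suc k)
  shift = solve-∀

up-raise : ∀ j → up (raise j) + down j ≡ up j + 3 + down (raise j)
up-raise +[ k ]        = shift k
  where
  shift : ∀ k → 3 * suc k + 0 ≡ 3 * k + 3 + 0
  shift = solve-∀
up-raise -[1+ zero ]   = refl
up-raise -[1+ suc k ]  = shift k
  where
  shift : ∀ k → 0 + 3 * suc (suc k) ≡ 0 + 3 + 3 * suc k
  shift = solve-∀

pentagonal-raise : ∀ j → pentagonal (raise j) + down j ≡ pentagonal j + (2 + up j)
pentagonal-raise +[ k ]       = shift k (progressionSum 3 2 k)
  where
  shift : ∀ k s → (2 + 3 * k + s) + 0 ≡ s + (2 + 3 * k)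
  shift = solve-∀
pentagonal-raise -[1+ zero ]  = refl
pentagonal-raise -[1+ suc k ] = shift k (progressionSum 3 1 (suc k))
  where
  shift : ∀ k s → s + 3 * suc (suc k) ≡ (1 + 3 * suc k + s) + (2 + 0)
  shift = solve-∀

-- On Young diagrams: removeColumn deletes the first column, addColumn h adds a first column
-- of height h ≥ length π, and addRow r adds a first row of length r (none when r = 0).
largestPart : List ℕ → ℕ
largestPart []      = 0
largestPart (x ∷ _) = x

removeColumn : List ℕ → List ℕ
removeColumn []                = []
removeColumn (zero ∷ π)        = removeColumn π
removeColumn (suc zero ∷ π)    = removeColumn π
removeColumn (suc (suc x) ∷ π) = suc x ∷ removeColumn π

addColumn : ℕ → List ℕ → List ℕ
addColumn h π = map suc π ++ replicate (h ∸ length π) 1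

addRow : ℕ → List ℕ → List ℕ
addRow zero    π = π
addRow (suc r) π = suc r ∷ π

sum-largestPart : ∀ π → largestPart π + sum (drop 1 π) ≡ sum π
sum-largestPart []      = refl
sum-largestPart (_ ∷ _) = refl

largestPart-drop1 : ∀ {π} → AllPairs _≥_ π → largestPart (drop 1 π) ≤ largestPart π
largestPart-drop1 []              = z≤n
largestPart-drop1 {_ ∷ []} _      = z≤n
largestPart-drop1 ((x≥y ∷ _) ∷ _) = x≥y

sum-removeColumn : ∀ {π} → All (0 <_) π → sum (removeColumn π) + length π ≡ sum π
sum-removeColumn [] = refl
sum-removeColumn {suc zero ∷ π} (_ ∷ π⁺) = trans (+-suc _ _) (cong suc (sum-removeColumn π⁺))
sum-removeColumn {suc (suc x) ∷ π} (_ ∷ π⁺) = cong suc (begin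
  x + sum (removeColumn π) + suc (length π) ≡⟨ +-suc _ _ ⟩
  suc (x + sum (removeColumn π) + length π) ≡⟨ cong suc (+-assoc x _ _) ⟩
  suc (x + (sum (removeColumn π) + length π)) ≡⟨ cong (suc ∘ (x +_)) (sum-removeColumn π⁺) ⟩
  suc (x + sum π)                             ∎)
  where open ≡-Reasoning

length-removeColumn : ∀ π → length (removeColumn π) ≤ length π
length-removeColumn []                = z≤n
length-removeColumn (zero ∷ π)        = m≤n⇒m≤1+n (length-removeColumn π)
length-removeColumn (suc zero ∷ π)    = m≤n⇒m≤1+n (length-removeColumn π)
length-removeColumn (suc (suc x) ∷ π) = s≤s (length-removeColumn π)

removeColumn-positive : ∀ π → All (0 <_) (removeColumn π)
removeColumn-positive []                = []
removeColumn-positive (zero ∷ π)        = removeColumn-positive π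
removeColumn-positive (suc zero ∷ π)    = removeColumn-positive π
removeColumn-positive (suc (suc x) ∷ π) = z<s ∷ removeColumn-positive π

∈-removeColumn⁻ : ∀ {z} π → z ∈ removeColumn π → suc z ∈ π
∈-removeColumn⁻ (zero ∷ π)        z∈          = there (∈-removeColumn⁻ π z∈)
∈-removeColumn⁻ (suc zero ∷ π)    z∈          = there (∈-removeColumn⁻ π z∈)
∈-removeColumn⁻ (suc (suc x) ∷ π) (here refl) = here refl
∈-removeColumn⁻ (suc (suc x) ∷ π) (there z∈)  = there (∈-removeColumn⁻ π z∈)

removeColumn-sorted : ∀ {π} → AllPairs _≥_ π → AllPairs _≥_ (removeColumn π)
removeColumn-sorted [] = []
removeColumn-sorted {zero ∷ π}        (_ ∷ sorted)     = removeColumn-sorted sorted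
removeColumn-sorted {suc zero ∷ π}    (_ ∷ sorted)     = removeColumn-sorted sorted
removeColumn-sorted {suc (suc x) ∷ π} (x≥π ∷ sorted) =
  All.tabulate (λ z∈ → ≤-pred (All.lookup x≥π (∈-removeColumn⁻ π z∈))) ∷ removeColumn-sorted sorted

removeColumn-<largestPart : ∀ {π} → AllPairs _≥_ π → All (_< largestPart π) (removeColumn π)
removeColumn-<largestPart [] = []
removeColumn-<largestPart {x ∷ π} (x≥π ∷ _) =
  All.tabulate λ z∈ → All.lookup (≤-refl ∷ x≥π) (∈-removeColumn⁻ (x ∷ π) z∈)

removeColumn-≤1 : ∀ {π} → All (_≤ 1) π → removeColumn π ≡ []
removeColumn-≤1 [] = refl
removeColumn-≤1 {zero ∷ π}     (_ ∷ π≤1) = removeColumn-≤1 π≤1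
removeColumn-≤1 {suc zero ∷ π} (_ ∷ π≤1) = removeColumn-≤1 π≤1
removeColumn-≤1 {suc (suc _) ∷ π} (s≤s () ∷ _)

length-addColumn : ∀ {h} π → length π ≤ h → length (addColumn h π) ≡ h
length-addColumn {h} π π≤h = begin
  length (map suc π ++ replicate (h ∸ length π) 1)
    ≡⟨ length-++ (map suc π) ⟩
  length (map suc π) + length (replicate (h ∸ length π) 1)
    ≡⟨ cong₂ _+_ (length-map suc π) (length-replicate (h ∸ length π)) ⟩
  length π + (h ∸ length π)
    ≡⟨ m+[n∸m]≡n π≤h ⟩
  h ∎
  where open ≡-Reasoning

sum-addColumn : ∀ {h} π → length π ≤ h → sum (addColumn h π) ≡ sum π + h
sum-addColumn {h} π π≤h = begin
  sum (map suc π ++ replicate (h ∸ length π) 1)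
    ≡⟨ sum-++ (map suc π) _ ⟩
  sum (map suc π) + sum (replicate (h ∸ length π) 1)
    ≡⟨ cong₂ _+_ (sum-map-suc π) (sum-ones (h ∸ length π)) ⟩
  sum π + length π + (h ∸ length π)
    ≡⟨ +-assoc (sum π) _ _ ⟩
  sum π + (length π + (h ∸ length π))
    ≡⟨ cong (sum π +_) (m+[n∸m]≡n π≤h) ⟩
  sum π + h ∎
  where
  open ≡-Reasoning
  sum-map-suc : ∀ π → sum (map suc π) ≡ sum π + length π
  sum-map-suc []      = refl
  sum-map-suc (x ∷ π) = begin
    suc (x + sum (map suc π))      ≡⟨ cong (suc ∘ (x +_)) (sum-map-suc π) ⟩
    suc (x + (sum π + length π))   ≡⟨ cong suc (+-assoc x _ _) ⟨
    suc (x + sum π + length π)     ≡⟨ +-suc _ _ ⟨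
    x + sum π + suc (length π)     ∎
  sum-ones : ∀ k → sum (replicate k 1) ≡ k
  sum-ones zero    = refl
  sum-ones (suc k) = cong suc (sum-ones k)

addColumn-sorted : ∀ {h π} → AllPairs _≥_ π → AllPairs _≥_ (addColumn h π)
addColumn-sorted {h} {π} sorted = AllPairs.++⁺ (AllPairs.map⁺ (AllPairs.map s≤s sorted)) ones-sorted
  (All.map⁺ (All.tabulate {xs = π} λ _ → All.replicate⁺ (h ∸ length π) (s≤s z≤n)))
  where
  ones-sorted : ∀ {k} → AllPairs _≥_ (replicate k 1)
  ones-sorted {zero}  = []
  ones-sorted {suc k} = All.replicate⁺ k ≤-refl ∷ ones-sorted

addColumn-positive : ∀ h π → All (0 <_) (addColumn h π)
addColumn-positive h π =
  All.++⁺ (All.map⁺ (All.tabulate {xs = π} λ _ → z<s)) (All.replicate⁺ (h ∸ length π) z<s)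

removeColumn-addColumn : ∀ {h π} → All (0 <_) π → removeColumn (addColumn h π) ≡ π
removeColumn-addColumn {h} {π} = go (h ∸ length π)
  where
  go : ∀ k {π} → All (0 <_) π → removeColumn (map suc π ++ replicate k 1) ≡ π
  go k [] = removeColumn-≤1 (All.replicate⁺ k ≤-refl)
  go k {suc x ∷ π} (_ ∷ π⁺) = cong (suc x ∷_) (go k π⁺)

addColumn-removeColumn : ∀ {π} → AllPairs _≥_ π → All (0 <_) π →
  addColumn (length π) (removeColumn π) ≡ π
addColumn-removeColumn [] [] = refl
addColumn-removeColumn {suc zero ∷ π} (1≥π ∷ sorted) (_ ∷ π⁺) = begin
  addColumn (suc (length π)) (removeColumn π) ≡⟨ cong (addColumn (suc (length π))) no-column ⟩
  1 ∷ addColumn (length π) []                 ≡⟨ cong (λ τ → 1 ∷ addColumn (length π) τ) no-column ⟨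
  1 ∷ addColumn (length π) (removeColumn π)   ≡⟨ cong (1 ∷_) (addColumn-removeColumn sorted π⁺) ⟩
  1 ∷ π                                       ∎
  where
  open ≡-Reasoning
  no-column = removeColumn-≤1 1≥π
addColumn-removeColumn {suc (suc x) ∷ π} (_ ∷ sorted) (_ ∷ π⁺) =
  cong (suc (suc x) ∷_) (addColumn-removeColumn sorted π⁺)

largestPart-addColumn : ∀ {h π m} → largestPart π ≤ m → largestPart (addColumn h π) ≤ suc m
largestPart-addColumn {zero}  {[]}    _   = z≤n
largestPart-addColumn {suc h} {[]}    _   = s≤s z≤n
largestPart-addColumn {π = x ∷ π}     x≤m = s≤s x≤m

addRow-sorted : ∀ {r π} → AllPairs _≥_ π → All (_≤ r) π → AllPairs _≥_ (addRow r π)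
addRow-sorted {zero}  sorted _   = sorted
addRow-sorted {suc r} sorted π≤r = π≤r ∷ sorted

addRow-positive : ∀ {r π} → All (0 <_) π → All (0 <_) (addRow r π)
addRow-positive {zero}  π⁺ = π⁺
addRow-positive {suc r} π⁺ = z<s ∷ π⁺

sum-addRow : ∀ r π → sum (addRow r π) ≡ r + sum π
sum-addRow zero    π = refl
sum-addRow (suc r) π = refl

length-addRow : ∀ r π → length (addRow r π) ≤ suc (length π)
length-addRow zero    π = n≤1+n (length π)
length-addRow (suc r) π = ≤-refl

addRow-split : ∀ {r π} → All (0 <_) π → All (_≤ r) π →
  largestPart (addRow r π) ≡ r × drop 1 (addRow r π) ≡ π
addRow-split {zero}  []             _              = refl , refl
addRow-split {zero}  (0<x ∷ _)      (x≤0 ∷ _)      = ⊥-elim (<⇒≱ 0<x x≤0)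
addRow-split {suc r} _              _              = refl , refl

addRow-largestPart : ∀ {π} → All (0 <_) π → addRow (largestPart π) (drop 1 π) ≡ π
addRow-largestPart []                    = refl
addRow-largestPart {suc x ∷ π} (_ ∷ _)   = refl

+-exchange : ∀ s′ w′ s w {a b} → s′ + a ≡ s + b → w′ + b ≡ w + a → s′ + w′ ≡ s + w
+-exchange s′ w′ s w {a} {b} sums weights = +-cancelʳ-≡ (a + b) _ _ (begin
  (s′ + w′) + (a + b) ≡⟨ interchange s′ w′ a b ⟩
  (s′ + a) + (w′ + b) ≡⟨ cong₂ _+_ sums weights ⟩
  (s + b) + (w + a)   ≡⟨ interchange s b w a ⟩
  (s + w) + (b + a)   ≡⟨ cong ((s + w) +_) (+-comm b a) ⟩
  (s + w) + (a + b)   ∎)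
  where open ≡-Reasoning

PentPartition : ℕ → ℤ × List ℕ → Set
PentPartition n (j , π) = AllPairs _≥_ π × All (0 <_) π × sum π + pentagonal j ≡ n

-- Writing ℓ for the length and λ₁ for the largest part:
-- if λ₁ ≤ ℓ + 3j, the first column becomes a first row of length ℓ + 3j − 1 and j decreases;
-- otherwise the first row becomes a first column of height λ₁ − 3j − 2 and j increases.
Low : ℤ → List ℕ → Set
Low j π = largestPart π + down j ≤ length π + up j

rowLength columnHeight : ℤ → List ℕ → ℕ
rowLength    j π = length π + up j ∸ suc (down j)
columnHeight j π = largestPart π + down j ∸ (2 + up j)

bz : ℤ × List ℕ → ℤ × List ℕ
bz (j , π) with largestPart π + down j ≤? length π + up j
... | yes _ = lower j , addRow (rowLength j π) (removeColumn π)
... | no _  = raise j , addColumn (columnHeight j π) (drop 1 π)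

bz-low : ∀ {j π} → Low j π → bz (j , π) ≡ (lower j , addRow (rowLength j π) (removeColumn π))
bz-low {j} {π} low with largestPart π + down j ≤? length π + up j
... | yes _   = refl
... | no high = ⊥-elim (high low)

bz-high : ∀ {j π} → ¬ Low j π → bz (j , π) ≡ (raise j , addColumn (columnHeight j π) (drop 1 π))
bz-high {j} {π} high with largestPart π + down j ≤? length π + up j
... | yes low = ⊥-elim (high low)
... | no _    = refl

parityℤ-bz : ∀ x → parityℤ (proj₁ (bz x)) ≡ parityℤ (proj₁ x) ⁻¹
parityℤ-bz (j , π) with largestPart π + down j ≤? length π + up j
... | yes _ = parityℤ-lower j
... | no _  = parityℤ-raise j

-- ℓ + 3j − 1 and λ₁ − 3j − 2 are never negative (given n ≥ 1), so rowLength and columnHeight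
-- do not truncate.
row-fits : ∀ {n j π} → 1 ≤ n → PentPartition n (j , π) → Low j π → suc (down j) ≤ length π + up j
row-fits {π = x ∷ π} _ (_ , 0<x ∷ _ , _) low = ≤-trans (+-monoˡ-≤ _ 0<x) low
row-fits {j = +[ zero ]}  {[]} 1≤n (_ , _ , 0≡n) _ = ⊥-elim (<⇒≢ 1≤n 0≡n)
row-fits {j = +[ suc k ]} {[]} _ _ _ = s≤s z≤n
row-fits {j = -[1+ k ]}   {[]} _ _ ()

column-fits : ∀ {n j π} → PentPartition n (j , π) → ¬ Low j π →
  length (drop 1 π) + (2 + up j) ≤ largestPart π + down j
column-fits {j = j} {π = x ∷ π} _ high =
  subst (_≤ x + down j) (sym (trans (+-suc _ _) (cong suc (+-suc _ _)))) (≰⇒> high)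
column-fits {j = +[ k ]}   {[]} _ high = ⊥-elim (high z≤n)
column-fits {j = -[1+ k ]} {[]} _ _    = subst (2 ≤_) (sym (*-suc 3 k)) (s≤s (s≤s z≤n))

module Lowered {n j π} (1≤n : 1 ≤ n) (π⊢ : PentPartition n (j , π)) (low : Low j π) where
  private
    sorted = proj₁ π⊢
    π⁺     = proj₁ (proj₂ π⊢)
    L  = length π
    r  = rowLength j π
    j′ = lower j
    μ  = addRow r (removeColumn π)

  r+1+d≡L+u : r + suc (down j) ≡ L + up j
  r+1+d≡L+u = m∸n+n≡m (row-fits {j = j} 1≤n π⊢ low)

  parts≤r : All (_≤ r) (removeColumn π)
  parts≤r = All.map (λ {z} z<largest → m+n≤o⇒m≤o∸n z
    (subst (_≤ L + up j) (sym (+-suc z (down j))) (≤-trans (+-monoˡ-≤ (down j) z<largest) low)))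
    (removeColumn-<largestPart sorted)

  split : largestPart μ ≡ r × drop 1 μ ≡ removeColumn π
  split = addRow-split (removeColumn-positive π) parts≤r

  sums : sum μ + suc (down j) ≡ sum π + up j
  sums = begin
    sum μ + suc (down j)                         ≡⟨ cong (_+ suc (down j)) (sum-addRow r _) ⟩
    r + sum (removeColumn π) + suc (down j)      ≡⟨ xy∙z≈xz∙y r _ _ ⟩
    r + suc (down j) + sum (removeColumn π)      ≡⟨ cong (_+ sum (removeColumn π)) r+1+d≡L+u ⟩
    L + up j + sum (removeColumn π)              ≡⟨ xy∙z≈zx∙y L (up j) _ ⟩
    sum (removeColumn π) + L + up j              ≡⟨ cong (_+ up j) (sum-removeColumn π⁺) ⟩
    sum π + up j                                 ∎
    where open ≡-Reasoning

  r+d′≡2+L+u′ : r + down j′ ≡ 2 + (L + up j′)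
  r+d′≡2+L+u′ = +-cancelʳ-≡ (suc (down j)) _ _ (begin
    r + down j′ + suc (down j)       ≡⟨ xy∙z≈xz∙y r _ _ ⟩
    r + suc (down j) + down j′       ≡⟨ cong (_+ down j′) r+1+d≡L+u ⟩
    L + up j + down j′               ≡⟨ +-assoc L _ _ ⟩
    L + (up j + down j′)             ≡⟨ cong (L +_) (up-lower j) ⟨
    L + (up j′ + 3 + down j)         ≡⟨ rearrange L (up j′) (down j) ⟩
    2 + (L + up j′) + suc (down j)   ∎)
    where
    open ≡-Reasoning
    rearrange : ∀ x y z → x + (y + 3 + z) ≡ 2 + (x + y) + suc z
    rearrange = solve-∀

  high : ¬ Low j′ μ
  high low′ = 1+n≰n (begin
    2 + (L + up j′)              ≡⟨ r+d′≡2+L+u′ ⟨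
    r + down j′                  ≡⟨ cong (_+ down j′) (proj₁ split) ⟨
    largestPart μ + down j′      ≤⟨ low′ ⟩
    length μ + up j′             ≤⟨ +-monoˡ-≤ (up j′) length-μ ⟩
    suc L + up j′                ∎)
    where
    open ≤-Reasoning
    length-μ : length μ ≤ suc L
    length-μ = ≤-trans (length-addRow r _) (s≤s (length-removeColumn π))

  height : columnHeight j′ μ ≡ L
  height = begin
    largestPart μ + down j′ ∸ (2 + up j′) ≡⟨ cong (λ x → x + down j′ ∸ (2 + up j′)) (proj₁ split) ⟩
    r + down j′ ∸ (2 + up j′)             ≡⟨ cong (_∸ (2 + up j′)) r+d′≡2+L+u′ ⟩
    L + up j′ ∸ up j′                     ≡⟨ m+n∸n≡m L (up j′) ⟩
    L                                     ∎
    where open ≡-Reasoning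

  partition : PentPartition n (j′ , μ)
  partition = addRow-sorted (removeColumn-sorted sorted) parts≤r , addRow-positive (removeColumn-positive π) ,
    trans (+-exchange (sum μ) (pentagonal j′) (sum π) (pentagonal j) sums (pentagonal-lower j))
      (proj₂ (proj₂ π⊢))

  back : bz (j′ , μ) ≡ (j , π)
  back = trans (bz-high high) (cong₂ _,_ (raise-lower j)
    (trans (cong₂ addColumn height (proj₂ split)) (addColumn-removeColumn sorted π⁺)))

module Raised {n j π} (π⊢ : PentPartition n (j , π)) (high : ¬ Low j π) where
  private
    sorted = proj₁ π⊢
    π⁺     = proj₁ (proj₂ π⊢)
    h  = largestPart π
    τ  = drop 1 π
    c  = columnHeight j π
    j′ = raise j
    μ  = addColumn c τ

  fits : length τ + (2 + up j) ≤ h + down j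
  fits = column-fits {j = j} π⊢ high

  c+2+u≡h+d : c + (2 + up j) ≡ h + down j
  c+2+u≡h+d = m∸n+n≡m (≤-trans (m≤n+m _ (length τ)) fits)

  τ≤c : length τ ≤ c
  τ≤c = m+n≤o⇒m≤o∸n (length τ) fits

  sums : sum μ + (2 + up j) ≡ sum π + down j
  sums = begin
    sum μ + (2 + up j)       ≡⟨ cong (_+ (2 + up j)) (sum-addColumn τ τ≤c) ⟩
    sum τ + c + (2 + up j)   ≡⟨ +-assoc (sum τ) c _ ⟩
    sum τ + (c + (2 + up j)) ≡⟨ cong (sum τ +_) c+2+u≡h+d ⟩
    sum τ + (h + down j)     ≡⟨ x∙yz≈yx∙z (sum τ) h (down j) ⟩
    h + sum τ + down j       ≡⟨ cong (_+ down j) (sum-largestPart π) ⟩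
    sum π + down j           ∎
    where open ≡-Reasoning

  c+u′≡1+h+d′ : c + up j′ ≡ suc (h + down j′)
  c+u′≡1+h+d′ = +-cancelʳ-≡ (2 + up j) _ _ (begin
    c + up j′ + (2 + up j)       ≡⟨ xy∙z≈xz∙y c _ _ ⟩
    c + (2 + up j) + up j′       ≡⟨ cong (_+ up j′) c+2+u≡h+d ⟩
    h + down j + up j′           ≡⟨ xy∙z≈x∙zy h (down j) (up j′) ⟩
    h + (up j′ + down j)         ≡⟨ cong (h +_) (up-raise j) ⟩
    h + (up j + 3 + down j′)     ≡⟨ rearrange h (up j) (down j′) ⟩
    suc (h + down j′) + (2 + up j) ∎)
    where
    open ≡-Reasoning
    rearrange : ∀ x y z → x + (y + 3 + z) ≡ suc (x + z) + (2 + y)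
    rearrange = solve-∀

  low : Low j′ μ
  low = begin
    largestPart μ + down j′ ≤⟨ +-monoˡ-≤ (down j′) largest-μ ⟩
    suc (h + down j′)       ≡⟨ c+u′≡1+h+d′ ⟨
    c + up j′               ≡⟨ cong (_+ up j′) (length-addColumn τ τ≤c) ⟨
    length μ + up j′        ∎
    where
    open ≤-Reasoning
    largest-μ : largestPart μ ≤ suc h
    largest-μ = largestPart-addColumn {c} {τ} (largestPart-drop1 sorted)

  row : rowLength j′ μ ≡ h
  row = begin
    length μ + up j′ ∸ suc (down j′) ≡⟨ cong (λ x → x + up j′ ∸ suc (down j′)) (length-addColumn τ τ≤c) ⟩
    c + up j′ ∸ suc (down j′)        ≡⟨ cong (_∸ suc (down j′)) c+u′≡1+h+d′ ⟩
    h + down j′ ∸ down j′            ≡⟨ m+n∸n≡m h (down j′) ⟩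
    h                                ∎
    where open ≡-Reasoning

  partition : PentPartition n (j′ , μ)
  partition = addColumn-sorted (AllPairs.drop⁺ 1 sorted) , addColumn-positive c τ ,
    trans (+-exchange (sum μ) (pentagonal j′) (sum π) (pentagonal j) sums (pentagonal-raise j))
      (proj₂ (proj₂ π⊢))

  back : bz (j′ , μ) ≡ (j , π)
  back = trans (bz-low low) (cong₂ _,_ (lower-raise j)
    (trans (cong₂ addRow row (removeColumn-addColumn (All.drop⁺ 1 π⁺))) (addRow-largestPart π⁺)))

bz-involutive : ∀ {n} → 1 ≤ n → ∀ {x} → PentPartition n x → PentPartition n (bz x) × bz (bz x) ≡ x
bz-involutive 1≤n {j , π} π⊢ with largestPart π + down j ≤? length π + up j
... | yes low = Lowered.partition {j = j} 1≤n π⊢ low , Lowered.back {j = j} 1≤n π⊢ low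
... | no high = Raised.partition {j = j} π⊢ high , Raised.back {j = j} π⊢ high

module _ {X : Set} where

  parityConcat : Parity → (ℕ → List X) → ℕ → List X
  parityConcat p  F zero    = []
  parityConcat 0ℙ F (suc m) = F 0 ++ parityConcat 1ℙ (F ∘ suc) m
  parityConcat 1ℙ F (suc m) = parityConcat 0ℙ (F ∘ suc) m

  length-parityConcat : ∀ {F : ℕ → List X} {c} → (∀ k → length (F k) ≡ c k) →
    ∀ p m → length (parityConcat p F m) ≡ paritySum p c m
  length-parityConcat F≡c p  zero    = refl
  length-parityConcat {F} F≡c 0ℙ (suc m) =
    trans (length-++ (F 0)) (cong₂ _+_ (F≡c 0) (length-parityConcat (F≡c ∘ suc) 1ℙ m))
  length-parityConcat F≡c 1ℙ (suc m) = length-parityConcat (F≡c ∘ suc) 0ℙ m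

  ∈-parityConcat⁻ : ∀ {F x} p m → x ∈ parityConcat p F m → ∃ λ k → parity k ≡ p × x ∈ F k
  ∈-parityConcat⁻ {F} 0ℙ (suc m) x∈ with ∈-++⁻ (F 0) x∈
  ... | inj₁ x∈F0 = 0 , refl , x∈F0
  ... | inj₂ x∈rest =
    let (k , parity≡ , x∈Fk) = ∈-parityConcat⁻ 1ℙ m x∈rest in suc k , parity-suc⁺ k parity≡ , x∈Fk
  ∈-parityConcat⁻ 1ℙ (suc m) x∈ =
    let (k , parity≡ , x∈Fk) = ∈-parityConcat⁻ 0ℙ m x∈ in suc k , parity-suc⁺ k parity≡ , x∈Fk

  ∈-parityConcat⁺ : ∀ {F x k p m} → k < m → parity k ≡ p → x ∈ F k → x ∈ parityConcat p F m
  ∈-parityConcat⁺ {k = zero}  {0ℙ} {suc m} _ _ x∈ = ∈-++⁺ˡ x∈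
  ∈-parityConcat⁺ {k = zero}  {1ℙ} _ () _
  ∈-parityConcat⁺ {F} {k = suc k} {0ℙ} {suc m} (s≤s k<m) parity≡ x∈ =
    ∈-++⁺ʳ (F 0) (∈-parityConcat⁺ k<m (parity-suc⁻ k parity≡) x∈)
  ∈-parityConcat⁺ {k = suc k} {1ℙ} {suc m} (s≤s k<m) parity≡ x∈ =
    ∈-parityConcat⁺ k<m (parity-suc⁻ k parity≡) x∈

  parityConcat-unique : ∀ {F} → (∀ k → Unique (F k)) → (∀ {k k′ x} → x ∈ F k → x ∈ F k′ → k ≡ k′) →
    ∀ p m → Unique (parityConcat p F m)
  parityConcat-unique uF tag p  zero    = []
  parityConcat-unique uF tag 0ℙ (suc m) = Unique.++⁺ (uF 0)
    (parityConcat-unique (uF ∘ suc) (λ x∈ x∈′ → suc-injective (tag x∈ x∈′)) 1ℙ m)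
    λ (x∈F0 , x∈rest) → let (_ , _ , x∈Fk) = ∈-parityConcat⁻ 1ℙ m x∈rest in 0≢1+n (tag x∈F0 x∈Fk)
  parityConcat-unique uF tag 1ℙ (suc m) =
    parityConcat-unique (uF ∘ suc) (λ x∈ x∈′ → suc-injective (tag x∈ x∈′)) 0ℙ m

k≤progressionSum : ∀ A {a} k → 0 < a → k ≤ progressionSum A a k
k≤progressionSum A zero    _   = z≤n
k≤progressionSum A (suc k) 0<a = +-mono-≤ (≤-trans 0<a (m≤m+n _ _)) (k≤progressionSum A k 0<a)

pentFibre : ℕ → ℤ → List (ℤ × List ℕ)
pentFibre n j with pentagonal j ≤? n
... | yes _ = map (j ,_) (partitions (n ∸ pentagonal j))
... | no _  = []

module _ (n : ℕ) where

  length-pentFibre : ∀ j → length (pentFibre n j) ≡ pMinus n (pentagonal j)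
  length-pentFibre j with pentagonal j ≤? n
  ... | yes _ = length-map (j ,_) (partitions (n ∸ pentagonal j))
  ... | no _  = refl

  ∈-pentFibre⁻ : ∀ {j x} → x ∈ pentFibre n j → proj₁ x ≡ j × PentPartition n x
  ∈-pentFibre⁻ {j} x∈ with pentagonal j ≤? n
  ... | yes ω≤n with ∈-map⁻ (j ,_) x∈
  ...   | π , π∈ , refl = let (sorted , π⁺ , sum≡) = ∈-partitions⁻ π∈
                          in refl , sorted , π⁺ , trans (cong (_+ pentagonal j) sum≡) (m∸n+n≡m ω≤n)

  ∈-pentFibre⁺ : ∀ {j π} → PentPartition n (j , π) → (j , π) ∈ pentFibre n j
  ∈-pentFibre⁺ {j} {π} (sorted , π⁺ , sum≡n) with pentagonal j ≤? n
  ... | yes _ = ∈-map⁺ (j ,_) (∈-partitions⁺ (sorted , π⁺ , sum≡n∸ω))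
    where
    sum≡n∸ω : sum π ≡ n ∸ pentagonal j
    sum≡n∸ω = trans (sym (m+n∸n≡m _ (pentagonal j))) (cong (_∸ pentagonal j) sum≡n)
  ... | no ω≰n = ⊥-elim (ω≰n (subst (pentagonal j ≤_) sum≡n (m≤n+m _ (sum π))))

  pentFibre-index : ∀ {j j′ x} → x ∈ pentFibre n j → x ∈ pentFibre n j′ → j ≡ j′
  pentFibre-index {j} {j′} x∈ x∈′ =
    trans (sym (proj₁ (∈-pentFibre⁻ {j} x∈))) (proj₁ (∈-pentFibre⁻ {j′} x∈′))

  pentFibre-unique : ∀ j → Unique (pentFibre n j)
  pentFibre-unique j with pentagonal j ≤? n
  ... | yes _ = Unique.map⁺ (λ { refl → refl }) (partitions-unique (n ∸ pentagonal j))
  ... | no _  = []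

  pentPairs : Parity → List (ℤ × List ℕ)
  pentPairs p =
    parityConcat p (pentFibre n ∘ +[_]) (suc n) ++ parityConcat (p ⁻¹) (pentFibre n ∘ -[1+_]) n

  length-pentPairs : ∀ p → length (pentPairs p) ≡
    paritySum p (λ k → pMinus n (pentagonal +[ k ])) (suc n) +
    paritySum (p ⁻¹) (λ k → pMinus n (pentagonal -[1+ k ])) n
  length-pentPairs p = trans (length-++ (parityConcat p (pentFibre n ∘ +[_]) (suc n)))
    (cong₂ _+_ (length-parityConcat (length-pentFibre ∘ +[_]) p (suc n))
               (length-parityConcat (length-pentFibre ∘ -[1+_]) (p ⁻¹) n))

  ∈-pentPairs⁻ : ∀ {p x} → x ∈ pentPairs p → PentPartition n x × parityℤ (proj₁ x) ≡ p
  ∈-pentPairs⁻ {p} x∈ with ∈-++⁻ (parityConcat p (pentFibre n ∘ +[_]) (suc n)) x∈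
  ... | inj₁ x∈+ = let (k , parity≡ , x∈Fk) = ∈-parityConcat⁻ p (suc n) x∈+
                       (j≡ , x⊢) = ∈-pentFibre⁻ {+[ k ]} x∈Fk
                   in x⊢ , trans (cong parityℤ j≡) parity≡
  ... | inj₂ x∈- = let (k , parity≡ , x∈Fk) = ∈-parityConcat⁻ (p ⁻¹) n x∈-
                       (j≡ , x⊢) = ∈-pentFibre⁻ { -[1+ k ]} x∈Fk
                   in x⊢ , trans (cong parityℤ j≡)
                                 (trans (parity-suc⁺ k parity≡) (Parity.⁻¹-involutive p))

  ∈-pentPairs⁺ : ∀ {p x} → PentPartition n x → parityℤ (proj₁ x) ≡ p → x ∈ pentPairs p
  ∈-pentPairs⁺ {p} {+[ k ] , π} x⊢@(_ , _ , sum≡n) parity≡ = ∈-++⁺ˡ (∈-parityConcat⁺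
    (s≤s (≤-trans (k≤progressionSum 3 k z<s) (subst (pentagonal +[ k ] ≤_) sum≡n (m≤n+m _ (sum π)))))
    parity≡ (∈-pentFibre⁺ x⊢))
  ∈-pentPairs⁺ {p} { -[1+ k ] , π} x⊢@(_ , _ , sum≡n) parity≡ = ∈-++⁺ʳ _ (∈-parityConcat⁺
    (≤-trans (k≤progressionSum 3 (suc k) z<s) (subst (pentagonal -[1+ k ] ≤_) sum≡n (m≤n+m _ (sum π))))
    (parity-suc⁻ k parity≡) (∈-pentFibre⁺ x⊢))

  pentPairs-unique : ∀ p → Unique (pentPairs p)
  pentPairs-unique p = Unique.++⁺
    (parityConcat-unique (pentFibre-unique ∘ +[_]) tag₊ p (suc n))
    (parityConcat-unique (pentFibre-unique ∘ -[1+_]) tag₋ (p ⁻¹) n)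
    λ (x∈₊ , x∈₋) →
      let (k , _ , x∈F₊) = ∈-parityConcat⁻ p (suc n) x∈₊
          (k′ , _ , x∈F₋) = ∈-parityConcat⁻ (p ⁻¹) n x∈₋
      in case pentFibre-index {+[ k ]} { -[1+ k′ ]} x∈F₊ x∈F₋ of λ ()
    where
    tag₊ : ∀ {k k′ x} → x ∈ pentFibre n +[ k ] → x ∈ pentFibre n +[ k′ ] → k ≡ k′
    tag₊ {k} {k′} x∈ x∈′ = ℤ.+-injective (pentFibre-index {+[ k ]} {+[ k′ ]} x∈ x∈′)
    tag₋ : ∀ {k k′ x} → x ∈ pentFibre n -[1+ k ] → x ∈ pentFibre n -[1+ k′ ] → k ≡ k′
    tag₋ {k} {k′} x∈ x∈′ = ℤ.-[1+-injective (pentFibre-index { -[1+ k ]} { -[1+ k′ ]} x∈ x∈′)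

  -- Euler: Σⱼ (−1)ʲ p(n − ω(j)) = 0 for n ≥ 1.
  pentagonal-recurrence : 1 ≤ n → length (pentPairs 0ℙ) ≡ length (pentPairs 1ℙ)
  pentagonal-recurrence 1≤n =
    bijection⇒length≡ ≟-pair ≟-pair (pentPairs-unique 0ℙ) (pentPairs-unique 1ℙ) bz bz flips flips
    (λ x∈ → proj₂ (bz-involutive 1≤n (proj₁ (∈-pentPairs⁻ x∈))))
    (λ x∈ → proj₂ (bz-involutive 1≤n (proj₁ (∈-pentPairs⁻ x∈))))
    where
    ≟-pair : DecidableEquality (ℤ × List ℕ)
    ≟-pair = ×-≡-dec ℤ._≟_ (≡-dec _≟_)
    flips : ∀ {p x} → x ∈ pentPairs p → bz x ∈ pentPairs (p ⁻¹)
    flips {x = x} x∈ = let (x⊢ , parity≡) = ∈-pentPairs⁻ x∈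
      in ∈-pentPairs⁺ (proj₁ (bz-involutive 1≤n x⊢)) (trans (parityℤ-bz x) (cong _⁻¹ parity≡))

theorem3p1 : (n : ℕ) → n ≥ 1 → pMex 3 1 n + pMex 3 2 n ≡ p n
theorem3p1 n 1≤n = +-cancelʳ-≡ (E₁ + O₂) _ _ (begin
  pMex 3 1 n + pMex 3 2 n + (E₁ + O₂)   ≡⟨ interchange (pMex 3 1 n) _ E₁ O₂ ⟩
  (pMex 3 1 n + E₁) + (pMex 3 2 n + O₂) ≡⟨ cong₂ _+_ (pMex-alternating 3 1 n z<s) mex₂ ⟩
  (p n + O₁) + E₂                       ≡⟨ +-assoc (p n) O₁ E₂ ⟩
  p n + (O₁ + E₂)                       ≡⟨ cong (p n +_) (trans (+-comm O₁ E₂) euler) ⟩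
  p n + (O₂ + E₁)                       ≡⟨ cong (p n +_) (+-comm O₂ E₁) ⟩
  p n + (E₁ + O₂)                       ∎)
  where
  open ≡-Reasoning
  c₁ c₂ : ℕ → ℕ
  c₁ k = pMinus n (progressionSum 3 1 k)
  c₂ k = pMinus n (progressionSum 3 2 k)
  E₁ = paritySum 0ℙ (c₁ ∘ suc) n
  O₁ = paritySum 1ℙ (c₁ ∘ suc) n
  E₂ = paritySum 0ℙ c₂ (suc n)
  O₂ = paritySum 1ℙ c₂ (suc n)
  euler : E₂ + O₁ ≡ O₂ + E₁
  euler = begin
    E₂ + O₁                   ≡⟨ length-pentPairs n 0ℙ ⟨
    length (pentPairs n 0ℙ)   ≡⟨ pentagonal-recurrence n 1≤n ⟩
    length (pentPairs n 1ℙ)   ≡⟨ length-pentPairs n 1ℙ ⟩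
    O₂ + E₁                   ∎
  mex₂ : pMex 3 2 n + O₂ ≡ E₂
  mex₂ = pMex-alternating 3 2 n z<s
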